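{- Let $\mathbb A$ be a nonempty finite alphabet, let $S_0=\mathbb A^+$ be the free semigroup over $\mathbb A$, and let $S_1$ be the set of variable words over $\mathbb A$. Define $\tau:S_1\to\mathbb N$ by $\tau(w)=|w|_{v_1}$ (the number of occurrences of the variable $v_1$ in $w$). Let $S_0$ be finitely colored and let $\langle x_n\rangle_{n=1}^\infty$ be a sequence in $\mathbb N$. Then there exists $w\in S_1$ such that $\{w(a):a\in\mathbb A\}$ is monochromatic and $\tau(w)\in FS(\langle x_n\rangle_{n=1}^\infty)$.
   Context: $\mathbb N=\{1,2,3,\dots\}$. $S_0=\mathbb A^+$ is the set of nonempty finite words over $\mathbb A$ under concatenation. $v_1$ is a symbol not in $\mathbb A$; a variable word over $\mathbb A$ is a nonempty finite word over $\mathbb A\cup\{v_1\}$ in which $v_1$ occurs at least once, and $S_1$ is the set of these. For $w\in S_1$ and $a\in\mathbb A$, $w(a)\in S_0$ is the word obtained by replacing each occurrence of $v_1$ in $w$ by $a$. A finite coloring of a set is a function from it into a finite set; a subset is monochromatic if the coloring is constant on it. $FS(\langle x_n\rangle_{n=1}^\infty)=\{\sum_{t\in F}x_t: F \text{ a finite nonempty subset of }\mathbb N\}$. -}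

module Defs where

open import Data.Nat using (ℕ; suc; _<_; _+_)
open import Data.Fin using (Fin)
open import Data.Maybe using (Maybe; just; nothing)
open import Data.List using (List; []; _∷_; map)
open import Data.Nat.ListAction using (sum)
open import Data.List.NonEmpty using (List⁺; _∷_; toList)
open import Data.List.Relation.Unary.Any using (Any)
open import Data.List.Relation.Unary.Unique.Propositional using (Unique)
open import Relation.Binary.PropositionalEquality using (_≡_)
open import Data.Product using (Σ; ∃; _×_; _,_)

Word⁺ : Set → Set
Word⁺ A = List⁺ A

-- Letters of A ∪ {v₁}: `just a` is the letter a, `nothing` is the variable v₁.
-- A variable word is a nonempty word over A ∪ {v₁} in which v₁ occurs.
IsVariableWord : {A : Set} → List⁺ (Maybe A) → Set
IsVariableWord w = Any (λ c → c ≡ nothing) (toList w)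

VarWord : Set → Set
VarWord A = Σ (List⁺ (Maybe A)) IsVariableWord

substLetter : {A : Set} → A → Maybe A → A
substLetter a (just b) = b
substLetter a nothing  = a

inst : {A : Set} → VarWord A → A → Word⁺ A
inst (w , _) a = Data.List.NonEmpty.map (substLetter a) w

isVar : {A : Set} → Maybe A → ℕ
isVar (just _) = 0
isVar nothing  = 1

τ : {A : Set} → VarWord A → ℕ
τ (w , _) = sum (map isVar (toList w))

-- FS(⟨x_n⟩) for x : ℕ → ℕ (index n ∈ ℕ = {1,2,...} encoded as n-1):
-- m ∈ FS x iff m = Σ_{t∈F} x t for some finite nonempty F ⊆ ℕ,
-- F given as a nonempty duplicate-free list.
InFS : (ℕ → ℕ) → ℕ → Set
InFS x m = ∃ λ (F : List⁺ ℕ) → Unique (toList F) × sum (map x (toList F)) ≡ m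

-- Shelah's proof of the Hales–Jewett theorem. For letters a ≠ b, pigeonholing the rows
-- a^i b^(n-i) against all continuations yields a variable word a^i v^(j-i) b^(n-j) whose
-- substitutions v := a and v := b colour alike before any continuation; iterating gives
-- consecutive variable words s₁ … s_m such that, in s₁(z₁)…s_m(z_m), replacing one z_k = a
-- by b never changes the colour. Identifying a with b then removes a letter from the alphabet.
-- For the corollary, colour a word by the colour of the word obtained by repeating its
-- n-th letter x n times. A monochromatic variable word v for that colouring expands to
-- one in which the variable occurs Σ x t times, t ranging over the variable positions of v
-- (at least one of them, since every x n ≥ 1).
module Submission where

open import Data.Nat using (ℕ; zero; suc; _+_; _*_; _^_; _∸_; _≤_; _<_; s≤s)
open import Data.Nat.Properties
  using (n<1+n; <⇒≤; <⇒≢; ≤-refl; ≤-trans; n≤1+n; suc-injective; +-comm; +-assoc;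
         +-∸-assoc; m∸n+n≡m; m+[n∸m]≡n; m<n⇒0<n∸m; *-zeroʳ; *-identityʳ)
open import Data.Fin using (Fin; zero; suc; toℕ; funToFin; finToFun)
open import Data.Fin.Properties using (pigeonhole; toℕ≤pred[n]; finToFun-funToFin)
open import Data.Maybe using (Maybe; just; nothing)
import Data.Maybe as Maybe
open import Data.List using (List; []; _∷_; _++_; map; length; replicate; tabulate; lookup)
open import Data.List.Properties
  using (length-++; length-map; map-++; map-∘; map-cong; map-replicate; length-replicate; ++-assoc;
         tabulate-cong; tabulate-lookup)
open import Data.Nat.ListAction using (sum)
open import Data.Nat.ListAction.Properties using (sum-++)
open import Data.List.NonEmpty using (_∷_)
open import Data.List.Relation.Unary.Any as Any using (Any; here; there)
open import Data.List.Relation.Unary.Any.Properties using (++⁺ˡ; ++⁺ʳ; map⁺)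
open import Data.List.Relation.Unary.All as All using (All; []; _∷_)
open import Data.List.Relation.Unary.AllPairs using ([]; _∷_)
open import Data.List.Relation.Unary.Unique.Propositional using (Unique)
open import Data.Product using (∃; ∃₂; _×_; _,_)
open import Function using (_∘_)
open import Relation.Binary.PropositionalEquality
open import Defs

funToFin-injective : ∀ {m n} (f g : Fin m → Fin n) → funToFin f ≡ funToFin g → f ≗ g
funToFin-injective {m} {n} f g eq k = begin
  f k                                 ≡⟨ sym (finToFun-funToFin f k) ⟩
  finToFun {n} {m} (funToFin f) k     ≡⟨ cong (λ e → finToFun {n} {m} e k) eq ⟩
  finToFun {n} {m} (funToFin g) k     ≡⟨ finToFun-funToFin g k ⟩
  g k                                 ∎
  where open ≡-Reasoning

pigeonhole-≗ : ∀ {m} R (f : ℕ → Fin m → Fin R) → ∃₂ λ i j → i < j × j ≤ R ^ m × f i ≗ f j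
pigeonhole-≗ {m} R f with pigeonhole (n<1+n (R ^ m)) (λ k → funToFin (f (toℕ k)))
... | i , j , i<j , eq = toℕ i , toℕ j , i<j , toℕ≤pred[n] j , funToFin-injective _ _ eq

wordOf : ∀ {T S} → Fin (T ^ S) → List (Fin T)
wordOf {T} {S} k = tabulate (finToFun {T} {S} k)

wordOf-funToFin-lookup : ∀ {T} (w : List (Fin T)) → wordOf (funToFin (lookup w)) ≡ w
wordOf-funToFin-lookup w = trans (tabulate-cong (finToFun-funToFin (lookup w))) (tabulate-lookup w)

∀-wordOf : ∀ {T S} (P : List (Fin T) → Set) → (∀ k → P (wordOf {T} {S} k)) →
  ∀ w → length w ≡ S → P w
∀-wordOf P h w refl = subst P (wordOf-funToFin-lookup w) (h (funToFin (lookup w)))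

replicate-+ : ∀ {A : Set} m n (y : A) → replicate (m + n) y ≡ replicate m y ++ replicate n y
replicate-+ zero    n y = refl
replicate-+ (suc m) n y = cong (y ∷_) (replicate-+ m n y)

∸-+-∸ : ∀ {i j n} → i ≤ j → j ≤ n → (j ∸ i) + (n ∸ j) ≡ n ∸ i
∸-+-∸ {i} {j} {n} i≤j j≤n = begin
  (j ∸ i) + (n ∸ j)   ≡⟨ +-comm (j ∸ i) (n ∸ j) ⟩
  (n ∸ j) + (j ∸ i)   ≡⟨ sym (+-∸-assoc (n ∸ j) i≤j) ⟩
  (n ∸ j + j) ∸ i     ≡⟨ cong (_∸ i) (m∸n+n≡m j≤n) ⟩
  n ∸ i               ∎
  where open ≡-Reasoning

HasVar : {A : Set} → List (Maybe A) → Set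
HasVar = Any (_≡ nothing)

hasVar-replicate : ∀ {A : Set} {n} → 1 ≤ n → HasVar (replicate n (nothing {A = A}))
hasVar-replicate (s≤s _) = here refl

hasVar-map : ∀ {A B : Set} {f : Maybe A → Maybe B} → f nothing ≡ nothing →
  ∀ {v} → HasVar v → HasVar (map f v)
hasVar-map f-var v-var = map⁺ (Any.map (λ { refl → f-var }) v-var)

module _ {A : Set} where

  substitute : A → List (Maybe A) → List A
  substitute a = map (substLetter a)

  substVar : Maybe A → Maybe A → Maybe A
  substVar y (just a) = just a
  substVar y nothing  = y

  substitute-substVar : ∀ a y s → substitute a (map (substVar y) s) ≡ substitute (substLetter a y) s
  substitute-substVar a y s = trans (sym (map-∘ s)) (map-cong letterwise s)
    where
    letterwise : substLetter a ∘ substVar y ≗ substLetter (substLetter a y)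
    letterwise (just _) = refl
    letterwise nothing  = refl

  -- Truncates to the shorter list; every use below supplies lists of equal length.
  fillWith : ∀ {B C : Set} → (B → Maybe A → C) → List (List (Maybe A)) → List B → List C
  fillWith f []       zs       = []
  fillWith f (s ∷ ss) []       = []
  fillWith f (s ∷ ss) (z ∷ zs) = map (f z) s ++ fillWith f ss zs

  fill : List (List (Maybe A)) → List A → List A
  fill = fillWith substLetter

  fillVar : List (List (Maybe A)) → List (Maybe A) → List (Maybe A)
  fillVar = fillWith substVar

  length-fillWith : ∀ {B C : Set} (f : B → Maybe A → C) ss zs → length zs ≡ length ss →
    length (fillWith f ss zs) ≡ sum (map length ss)
  length-fillWith f []       []       eq = refl
  length-fillWith f (s ∷ ss) (z ∷ zs) eq = trans (length-++ (map (f z) s))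
    (cong₂ _+_ (length-map (f z) s) (length-fillWith f ss zs (suc-injective eq)))

  substitute-fillVar : ∀ a ss ys → substitute a (fillVar ss ys) ≡ fill ss (substitute a ys)
  substitute-fillVar a []       ys       = refl
  substitute-fillVar a (s ∷ ss) []       = refl
  substitute-fillVar a (s ∷ ss) (y ∷ ys) = trans (map-++ (substLetter a) (map (substVar y) s) _)
    (cong₂ _++_ (substitute-substVar a y s) (substitute-fillVar a ss ys))

  hasVar-fillVar : ∀ {ss ys} → All HasVar ss → length ys ≡ length ss → HasVar ys →
    HasVar (fillVar ss ys)
  hasVar-fillVar {[]}     {_ ∷ _} _              ()
  hasVar-fillVar {s ∷ ss} {_ ∷ _} (s-var ∷ _)    _  (here refl) = ++⁺ˡ (hasVar-map refl s-var)
  hasVar-fillVar {s ∷ ss} {y ∷ _} (_ ∷ ss-var)   eq (there p)   =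
    ++⁺ʳ (map (substVar y) s) (hasVar-fillVar ss-var (suc-injective eq) p)

substitute-map : ∀ {A B : Set} (f : A → B) a v →
  substitute (f a) (map (Maybe.map f) v) ≡ map f (substitute a v)
substitute-map f a v = trans (sym (map-∘ v)) (trans (map-cong letterwise v) (map-∘ v))
  where
  letterwise : substLetter (f a) ∘ Maybe.map f ≗ f ∘ substLetter a
  letterwise (just _) = refl
  letterwise nothing  = refl

module ShelahInsensitivity {T : ℕ} (a b : Fin T) where

  Insensitive : ∀ {R} → List (List (Maybe (Fin T))) → (List (Fin T) → Fin R) → Set
  Insensitive ss c = ∀ ps qs → length ps + suc (length qs) ≡ length ss →
    c (fill ss (ps ++ a ∷ qs)) ≡ c (fill ss (ps ++ b ∷ qs))

  insensitive-substitute : ∀ {R ss} {c : List (Fin T) → Fin R} → Insensitive ss c →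
    ∀ v → length v ≡ length ss → c (fill ss (substitute a v)) ≡ c (fill ss (substitute b v))
  insensitive-substitute {ss = ss} {c} insensitive = swapFrom []
    where
    length-snoc : ∀ ps z v → length ps + suc (length v) ≡ length ss →
      length (ps ++ z ∷ []) + length v ≡ length ss
    length-snoc ps z v eq =
      trans (cong (_+ length v) (length-++ ps)) (trans (+-assoc (length ps) 1 (length v)) eq)

    shift : ∀ ps z {qs qs′} →
      c (fill ss ((ps ++ z ∷ []) ++ qs)) ≡ c (fill ss ((ps ++ z ∷ []) ++ qs′)) →
      c (fill ss (ps ++ z ∷ qs)) ≡ c (fill ss (ps ++ z ∷ qs′))
    shift ps z {qs} {qs′} = subst₂ (λ u u′ → c (fill ss u) ≡ c (fill ss u′))
      (++-assoc ps (z ∷ []) qs) (++-assoc ps (z ∷ []) qs′)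

    swapFrom : ∀ ps v → length ps + length v ≡ length ss →
      c (fill ss (ps ++ substitute a v)) ≡ c (fill ss (ps ++ substitute b v))
    swapFrom ps []           eq = refl
    swapFrom ps (just z ∷ v) eq = shift ps z (swapFrom (ps ++ z ∷ []) v (length-snoc ps z v eq))
    swapFrom ps (nothing ∷ v) eq =
      trans (insensitive ps (substitute a v)
               (trans (cong (λ k → length ps + suc k) (length-map _ v)) eq))
            (shift ps b (swapFrom (ps ++ b ∷ []) v (length-snoc ps b v eq)))

  block : ℕ → ℕ → List (Fin T)
  block n i = replicate i a ++ replicate (n ∸ i) b

  seg : ℕ → ℕ → ℕ → List (Maybe (Fin T))
  seg n i j = replicate i (just a) ++ replicate (j ∸ i) nothing ++ replicate (n ∸ j) (just b)

  substitute-seg : ∀ z n i j →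
    substitute z (seg n i j) ≡ replicate i a ++ replicate (j ∸ i) z ++ replicate (n ∸ j) b
  substitute-seg z n i j = trans (map-++ (substLetter z) (replicate i (just a)) _)
    (cong₂ _++_ (map-replicate _ i _)
      (trans (map-++ (substLetter z) (replicate (j ∸ i) nothing) _)
        (cong₂ _++_ (map-replicate _ (j ∸ i) _) (map-replicate _ (n ∸ j) _))))

  substitute-a-seg : ∀ {n i j} → i ≤ j → substitute a (seg n i j) ≡ block n j
  substitute-a-seg {n} {i} {j} i≤j = begin
    substitute a (seg n i j)                                    ≡⟨ substitute-seg a n i j ⟩
    replicate i a ++ replicate (j ∸ i) a ++ replicate (n ∸ j) b
      ≡⟨ sym (++-assoc (replicate i a) _ _) ⟩
    (replicate i a ++ replicate (j ∸ i) a) ++ replicate (n ∸ j) b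
      ≡⟨ cong (_++ replicate (n ∸ j) b) (sym (replicate-+ i (j ∸ i) a)) ⟩
    replicate (i + (j ∸ i)) a ++ replicate (n ∸ j) b
      ≡⟨ cong (λ k → replicate k a ++ replicate (n ∸ j) b) (m+[n∸m]≡n i≤j) ⟩
    block n j                                                   ∎
    where open ≡-Reasoning

  substitute-b-seg : ∀ {n i j} → i ≤ j → j ≤ n → substitute b (seg n i j) ≡ block n i
  substitute-b-seg {n} {i} {j} i≤j j≤n = begin
    substitute b (seg n i j)                                    ≡⟨ substitute-seg b n i j ⟩
    replicate i a ++ replicate (j ∸ i) b ++ replicate (n ∸ j) b
      ≡⟨ cong (replicate i a ++_) (sym (replicate-+ (j ∸ i) (n ∸ j) b)) ⟩
    replicate i a ++ replicate ((j ∸ i) + (n ∸ j)) b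
      ≡⟨ cong (λ k → replicate i a ++ replicate k b) (∸-+-∸ i≤j j≤n) ⟩
    block n i                                                   ∎
    where open ≡-Reasoning

  length-seg : ∀ {n i j} → i ≤ j → j ≤ n → length (seg n i j) ≡ n
  length-seg {n} {i} {j} i≤j j≤n = begin
    length (seg n i j)                  ≡⟨ sym (length-map (substLetter b) (seg n i j)) ⟩
    length (substitute b (seg n i j))   ≡⟨ cong length (substitute-b-seg i≤j j≤n) ⟩
    length (block n i)                  ≡⟨ length-++ (replicate i a) ⟩
    length (replicate i a) + length (replicate (n ∸ i) b)
      ≡⟨ cong₂ _+_ (length-replicate i) (length-replicate (n ∸ i)) ⟩
    i + (n ∸ i)                         ≡⟨ m+[n∸m]≡n (≤-trans i≤j j≤n) ⟩
    n                                   ∎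
    where open ≡-Reasoning

  hasVar-seg : ∀ {n i j} → i < j → HasVar (seg n i j)
  hasVar-seg {i = i} i<j =
    ++⁺ʳ (replicate i (just a)) (++⁺ˡ (hasVar-replicate (m<n⇒0<n∸m i<j)))

  insensitive-∷ : ∀ {R S n i j ss} {c : List (Fin T) → Fin R} → i ≤ j → j ≤ n →
    (∀ w → length w ≡ S → c (block n i ++ w) ≡ c (block n j ++ w)) →
    sum (map length ss) ≡ S →
    Insensitive ss (λ w → funToFin (λ z → c (substitute z (seg n i j) ++ w))) →
    Insensitive (seg n i j ∷ ss) c
  insensitive-∷ {S = S} {n} {i} {j} {ss} {c} i≤j j≤n rows sum-ss _ [] qs eq = begin
    c (substitute a (seg n i j) ++ w)  ≡⟨ cong (λ u → c (u ++ w)) (substitute-a-seg i≤j) ⟩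
    c (block n j ++ w)                 ≡⟨ sym (rows w length-w) ⟩
    c (block n i ++ w)                 ≡⟨ cong (λ u → c (u ++ w)) (sym (substitute-b-seg i≤j j≤n)) ⟩
    c (substitute b (seg n i j) ++ w)  ∎
    where
    open ≡-Reasoning
    w : List (Fin T)
    w = fill ss qs
    length-w : length w ≡ S
    length-w = trans (length-fillWith substLetter ss qs (suc-injective eq)) sum-ss
  insensitive-∷ _ _ _ _ insensitive (p ∷ ps) qs eq =
    funToFin-injective _ _ (insensitive ps qs (suc-injective eq)) p

  Insensitivity : ℕ → ℕ → ℕ → Set
  Insensitivity m R S = ∀ (c : List (Fin T) → Fin R) →
    ∃ λ ss → length ss ≡ m × sum (map length ss) ≡ S × All HasVar ss × Insensitive ss c

  insensitivity : ∀ m R → ∃ (Insensitivity m R)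
  insensitivity zero    R = 0 , λ c → [] , refl , refl , [] , λ { [] _ () ; (_ ∷ _) _ () }
  insensitivity (suc m) R with insensitivity m (R ^ T)
  ... | S , insensitivity-m = n + S , extend
    where
    n : ℕ
    n = R ^ (T ^ S)
    extend : Insensitivity (suc m) R (n + S)
    extend c with pigeonhole-≗ R (λ i k → c (block n i ++ wordOf {T} {S} k))
    ... | i , j , i<j , j≤n , rows
      -- one colour with R ^ T values records the colours of s(z) ++ w for all letters z at once
      with insensitivity-m (λ w → funToFin (λ z → c (substitute z (seg n i j) ++ w)))
    ... | ss , length-ss , sum-ss , ss-var , insensitive =
      seg n i j ∷ ss , cong suc length-ss , cong₂ _+_ (length-seg (<⇒≤ i<j) j≤n) sum-ss ,
      hasVar-seg i<j ∷ ss-var ,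
      insensitive-∷ {ss = ss} {c} (<⇒≤ i<j) j≤n
        (∀-wordOf (λ w → c (block n i ++ w) ≡ c (block n j ++ w)) rows) sum-ss insensitive

HalesJewett : ℕ → ℕ → ℕ → Set
HalesJewett t r N = ∀ (c : List (Fin (suc t)) → Fin r) →
  ∃ λ v → length v ≡ N × HasVar v × ∃ λ i → ∀ a → c (substitute a v) ≡ i

hales-jewett-step : ∀ {t r N S} → HalesJewett t r N →
  ShelahInsensitivity.Insensitivity {suc (suc t)} zero (suc zero) N r S → HalesJewett (suc t) r S
hales-jewett-step {t} {S = S} hj insensitivity c with insensitivity c
... | ss , length-ss , sum-ss , ss-var , insensitive with hj (λ y → c (fill ss (map suc y)))
... | v , length-v , v-var , i , v-mono = W , length-W , W-var , i , W-mono
  where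
  v′ W : List (Maybe (Fin (suc (suc t))))
  v′ = map (Maybe.map suc) v
  W  = fillVar ss v′

  length-v′ : length v′ ≡ length ss
  length-v′ = trans (length-map _ v) (trans length-v (sym length-ss))

  length-W : length W ≡ S
  length-W = trans (length-fillWith substVar ss v′ length-v′) sum-ss

  W-var : HasVar W
  W-var = hasVar-fillVar ss-var length-v′ (hasVar-map refl v-var)

  W-mono : ∀ a → c (substitute a W) ≡ i
  W-mono (suc x) = begin
    c (substitute (suc x) W)                ≡⟨ cong c (substitute-fillVar (suc x) ss v′) ⟩
    c (fill ss (substitute (suc x) v′))     ≡⟨ cong (c ∘ fill ss) (substitute-map suc x v) ⟩
    c (fill ss (map suc (substitute x v)))  ≡⟨ v-mono x ⟩
    i                                       ∎
    where open ≡-Reasoning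
  W-mono zero = begin
    c (substitute zero W)                   ≡⟨ cong c (substitute-fillVar zero ss v′) ⟩
    c (fill ss (substitute zero v′))
      ≡⟨ ShelahInsensitivity.insensitive-substitute zero (suc zero) {ss = ss} {c}
           insensitive v′ length-v′ ⟩
    c (fill ss (substitute (suc zero) v′))  ≡⟨ cong c (sym (substitute-fillVar (suc zero) ss v′)) ⟩
    c (substitute (suc zero) W)             ≡⟨ W-mono (suc zero) ⟩
    i                                       ∎
    where open ≡-Reasoning

hales-jewett : ∀ t r → ∃ (HalesJewett t r)
hales-jewett zero    r =
  1 , λ c → nothing ∷ [] , refl , here refl , c (zero ∷ []) , λ { zero → refl }
hales-jewett (suc t) r with hales-jewett t r
... | N , hj with ShelahInsensitivity.insensitivity zero (suc zero) N r
... | S , insensitivity = S , hales-jewett-step hj insensitivity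

countVar : {A : Set} → List (Maybe A) → ℕ
countVar w = sum (map isVar w)

countVar-replicate : ∀ {A : Set} n (y : Maybe A) → countVar (replicate n y) ≡ n * isVar y
countVar-replicate zero    y = refl
countVar-replicate (suc n) y = cong (isVar y +_) (countVar-replicate n y)

countVar-++ : ∀ {A : Set} (u w : List (Maybe A)) → countVar (u ++ w) ≡ countVar u + countVar w
countVar-++ u w = trans (cong sum (map-++ isVar u w)) (sum-++ (map isVar u) (map isVar w))

varPositions : {A : Set} → ℕ → List (Maybe A) → List ℕ
varPositions i []            = []
varPositions i (just _ ∷ v)  = varPositions (suc i) v
varPositions i (nothing ∷ v) = i ∷ varPositions (suc i) v

varPositions-≥ : ∀ {A : Set} i (v : List (Maybe A)) → All (i ≤_) (varPositions i v)
varPositions-≥ i []            = []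
varPositions-≥ i (just _ ∷ v)  = All.map (≤-trans (n≤1+n i)) (varPositions-≥ (suc i) v)
varPositions-≥ i (nothing ∷ v) = ≤-refl ∷ All.map (≤-trans (n≤1+n i)) (varPositions-≥ (suc i) v)

varPositions-unique : ∀ {A : Set} i (v : List (Maybe A)) → Unique (varPositions i v)
varPositions-unique i []            = []
varPositions-unique i (just _ ∷ v)  = varPositions-unique (suc i) v
varPositions-unique i (nothing ∷ v) =
  All.map <⇒≢ (varPositions-≥ (suc i) v) ∷ varPositions-unique (suc i) v

varPositions-nonempty : ∀ {A : Set} i (v : List (Maybe A)) → HasVar v →
  ∃₂ λ j js → varPositions i v ≡ j ∷ js
varPositions-nonempty i (just _ ∷ v)  (there p) = varPositions-nonempty (suc i) v p
varPositions-nonempty i (nothing ∷ v) _         = i , varPositions (suc i) v , refl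

module _ (x : ℕ → ℕ) where

  expand : {A : Set} → ℕ → List A → List A
  expand i []      = []
  expand i (y ∷ u) = replicate (x i) y ++ expand (suc i) u

  map-expand : ∀ {A B : Set} (f : A → B) i u → map f (expand i u) ≡ expand i (map f u)
  map-expand f i []      = refl
  map-expand f i (y ∷ u) = trans (map-++ f (replicate (x i) y) _)
    (cong₂ _++_ (map-replicate f (x i) y) (map-expand f (suc i) u))

  hasVar-expand : ∀ {A : Set} → (∀ n → 1 ≤ x n) →
    ∀ i (v : List (Maybe A)) → HasVar v → HasVar (expand i v)
  hasVar-expand x≥1 i (_ ∷ v) (here refl) = ++⁺ˡ (hasVar-replicate (x≥1 i))
  hasVar-expand x≥1 i (y ∷ v) (there p)   =
    ++⁺ʳ (replicate (x i) y) (hasVar-expand x≥1 (suc i) v p)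

  countVar-expand : ∀ {A : Set} i (v : List (Maybe A)) →
    countVar (expand i v) ≡ sum (map x (varPositions i v))
  countVar-expand i []           = refl
  countVar-expand i (just a ∷ v) =
    trans (countVar-++ (replicate (x i) (just a)) _)
      (cong₂ _+_ (trans (countVar-replicate (x i) (just a)) (*-zeroʳ (x i)))
                 (countVar-expand (suc i) v))
  countVar-expand i (nothing ∷ v) =
    trans (countVar-++ (replicate (x i) nothing) _)
      (cong₂ _+_ (trans (countVar-replicate (x i) nothing) (*-identityʳ (x i)))
                 (countVar-expand (suc i) v))

  InFS-countVar-expand : ∀ {A : Set} i (v : List (Maybe A)) → HasVar v →
    InFS x (countVar (expand i v))
  InFS-countVar-expand i v v-var with varPositions-nonempty i v v-var
  ... | j , js , eq = j ∷ js , subst Unique eq (varPositions-unique i v) ,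
                      trans (cong (sum ∘ map x) (sym eq)) (sym (countVar-expand i v))

toVarWord : {A : Set} (w : List (Maybe A)) → HasVar w → VarWord A
toVarWord (y ∷ w) w-var = (y ∷ w) , w-var

τ-toVarWord : ∀ {A : Set} (w : List (Maybe A)) w-var → τ (toVarWord w w-var) ≡ countVar w
τ-toVarWord (y ∷ w) w-var = refl

-- The default letter only matters for the empty word, which is never coloured below.
colourOfList : ∀ {A C : Set} → (Word⁺ A → C) → A → List A → C
colourOfList c d []      = c (d ∷ [])
colourOfList c d (a ∷ u) = c (a ∷ u)

colour-inst-toVarWord : ∀ {A C : Set} (c : Word⁺ A → C) d (w : List (Maybe A)) w-var a →
  c (inst (toVarWord w w-var) a) ≡ colourOfList c d (substitute a w)
colour-inst-toVarWord c d (y ∷ w) w-var a = refl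

corollary2p5 : (k r : ℕ) → (c : Word⁺ (Fin (suc k)) → Fin r) → (x : ℕ → ℕ) → (∀ n → 1 ≤ x n)
    → ∃ λ (w : VarWord (Fin (suc k)))
        → (∃ λ (i : Fin r) → ∀ (a : Fin (suc k)) → c (inst w a) ≡ i)
        × InFS x (τ w)
corollary2p5 k r c x x≥1 with hales-jewett k r
... | _ , hj with hj (colourOfList c zero ∘ expand x 0)
... | v , _ , v-var , i , v-mono = w , (i , w-mono) , w-InFS
  where
  w-var : HasVar (expand x 0 v)
  w-var = hasVar-expand x x≥1 0 v v-var

  w : VarWord (Fin (suc k))
  w = toVarWord (expand x 0 v) w-var

  w-mono : ∀ a → c (inst w a) ≡ i
  w-mono a = trans (colour-inst-toVarWord c zero (expand x 0 v) w-var a)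
    (trans (cong (colourOfList c zero) (map-expand x (substLetter a) 0 v)) (v-mono a))

  w-InFS : InFS x (τ w)
  w-InFS = subst (InFS x) (sym (τ-toVarWord (expand x 0 v) w-var))
    (InFS-countVar-expand x 0 v v-var)
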